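{- Let $(G,H)$ be dense and let $u\in V(G)$ be a vertex that is not a cut vertex of $G$. Then either $D^+_{G,H}(u)$ contains two consecutive integers, or $D^+_{G,H}(u)$ consists of all the odd integers in $[0,d_G(u)]$, or it consists of all the even integers in $[0,d_G(u)]$.
   Context: $G$ is a graph without loops, $H:V(G)\to 2^{\mathbb{N}}$, and $d^+_O(v)$ is the out-degree of $v$ under orientation $O$. The pair $(G,H)$ is dense if $G$ is connected and for every $v\in V(G)$ and every integer $i$ with $0\le i\le d_G(v)-1$: if $i\notin H(v)$ then $i+1\in H(v)$. $D^+_{G,H}(u)=\{d^+_O(u): O \text{ an orientation of } G \text{ with } d^+_O(x)\in H(x)\text{ for all }x\in V(G)\setminus\{u\}\}$. $[s,t]=\{s,s+1,\dots,t\}$. -}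

module Defs where

open import Data.Nat using (ℕ; zero; suc; _+_; _≤_; _<_; _%_)
open import Data.Fin using (Fin)
open import Data.Bool using (Bool; true; false; if_then_else_)
open import Data.Product using (Σ; _×_; _,_; proj₁; proj₂; ∃; ∃-syntax)
open import Data.Sum using (_⊎_)
open import Data.List using (List; map)
open import Data.Nat.ListAction using (sum)
open import Data.Unit using (⊤)
open import Data.List.Base using (allFin)
open import Relation.Binary.PropositionalEquality using (_≡_; _≢_)
open import Relation.Nullary using (¬_)
open import Data.Fin using (_≟_)
open import Relation.Nullary.Decidable using (⌊_⌋)

record Graph : Set where
  field
    n     : ℕ
    m     : ℕ
    end₁  : Fin m → Fin n
    end₂  : Fin m → Fin n
    loopless : ∀ e → end₁ e ≢ end₂ e
open Graph public

Vertex : Graph → Set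
Vertex G = Fin (n G)

count : ∀ {m} → (Fin m → Bool) → ℕ
count {m} p = sum (map (λ i → if p i then 1 else 0) (allFin m))

_==_ : ∀ {k} → Fin k → Fin k → Bool
x == y = ⌊ x ≟ y ⌋

-- degree: number of edges incident with v (no loops, so each edge counts once)
deg : (G : Graph) → Vertex G → ℕ
deg G v = count (λ e → if end₁ G e == v then true else end₂ G e == v)

-- an orientation chooses for every edge a direction:
-- true  : end₁ e → end₂ e ;  false : end₂ e → end₁ e
Orientation : Graph → Set
Orientation G = Fin (m G) → Bool

tailOf : (G : Graph) → Orientation G → Fin (m G) → Vertex G
tailOf G O e = if O e then end₁ G e else end₂ G e

outdeg : (G : Graph) → Orientation G → Vertex G → ℕ
outdeg G O v = count (λ e → tailOf G O e == v)

Adj : (G : Graph) → Vertex G → Vertex G → Set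
Adj G x y = ∃[ e ] ((end₁ G e ≡ x × end₂ G e ≡ y) ⊎ (end₁ G e ≡ y × end₂ G e ≡ x))

data WalkAvoiding (G : Graph) (P : Vertex G → Set) : Vertex G → Vertex G → Set where
  here : ∀ {x} → P x → WalkAvoiding G P x x
  step : ∀ {x y z} → P x → Adj G x y → WalkAvoiding G P y z → WalkAvoiding G P x z

Connected : Graph → Set
Connected G = ∀ x y → WalkAvoiding G (λ _ → ⊤) x y

-- u is a cut vertex: removing u increases the number of components,
-- i.e. there are x , y ≠ u joined in G but not in G - u.
IsCutVertex : (G : Graph) → Vertex G → Set
IsCutVertex G u = ∃[ x ] ∃[ y ] (x ≢ u × y ≢ u × WalkAvoiding G (λ _ → ⊤) x y
                                 × ¬ WalkAvoiding G (λ z → z ≢ u) x y)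

-- H : V(G) → 2^ℕ, subsets of ℕ given by characteristic functions
ListAssignment : Graph → Set
ListAssignment G = Vertex G → ℕ → Bool

_∈H_ : ℕ → Bool → Set
i ∈H b = b ≡ true

Dense : (G : Graph) → ListAssignment G → Set
Dense G H = Connected G ×
  (∀ v i → i < deg G v → ¬ (H v i ≡ true) → H v (suc i) ≡ true)

InDplus : (G : Graph) → ListAssignment G → Vertex G → ℕ → Set
InDplus G H u k = ∃[ O ] (outdeg G O u ≡ k × (∀ x → x ≢ u → H x (outdeg G O x) ≡ true))

Even Odd : ℕ → Set
Even k = k % 2 ≡ 0
Odd  k = k % 2 ≡ 1

{-# OPTIONS --safe #-}
-- Induction on d = deg u. For an edge e = uw, an orientation of G either directs e away from u,
-- adding one to the out-degree of u, or towards u, using up one unit of the out-degree of w. Hence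
-- D⁺ is the union of D⁺_{G−e,H'}(u), where H' shifts the list of w down by one, and 1 + D⁺_{G−e,H}(u).
-- For d ≥ 2 both pairs stay dense and u stays a non-cut vertex of degree d − 1, so each piece has
-- one of the three shapes; two pieces of the same parity contain 0,1 or 1,2, and pieces of
-- opposite parity fit together into all integers of one parity in [0, d].
-- For d ≤ 1 (where deleting e may isolate u) it suffices that D⁺ is nonempty. That follows by
-- induction on the number of edges, with a growing set of free (unconstrained) vertices: delete an
-- edge from a free p to some q, make q free as well, and afterwards direct the edge towards q if
-- H(q) already contains the out-degree of q, and towards p otherwise, which density permits.
module Submission where

open import Defs
open import Data.Nat using (ℕ; zero; suc; pred; _+_; _≤_; _<_; z≤n; s≤s)
import Data.Nat.Properties as ℕ
open import Algebra.Properties.CommutativeSemigroup ℕ.+-commutativeSemigroup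
  using (x∙yz≈y∙xz)
open import Data.Fin using (Fin; zero; suc; punchIn; punchOut; _≟_)
open import Data.Fin.Properties using (¬Fin0; punchIn-punchOut; any?; all?)
open import Data.Fin.Subset.Properties using (anySubset?)
open import Data.Vec using (lookup; tabulate)
open import Data.Vec.Properties using (lookup∘tabulate)
open import Data.Vec.Functional using (insertAt)
open import Data.Vec.Functional.Properties using (insertAt-lookup; insertAt-punchIn)
open import Data.Bool using (Bool; true; false; not; if_then_else_; _∨_)
import Data.Bool.Properties as Bool
open import Data.List using (allFin)
open import Data.List.Properties using (map-tabulate; map-cong)
open import Data.Nat.ListAction using (sum)
open import Data.Product using (_×_; _,_; proj₂; map₂; ∃; ∃-syntax)
open import Data.Sum using (_⊎_; inj₁; inj₂)
open import Data.Unit using (⊤; tt)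
open import Data.Empty using (⊥; ⊥-elim)
open import Function using (_∘_; id)
open import Function.Bundles using (_⇔_; mk⇔; Equivalence)
open import Relation.Binary.PropositionalEquality
  using (_≡_; _≢_; refl; sym; trans; cong; cong₂; subst; module ≡-Reasoning)
open import Relation.Nullary using (¬_; Dec; yes; no)
open import Relation.Nullary.Decidable
  using (isYes≗does; dec-true; dec-false; map′; ¬?; _×-dec_; _⊎-dec_; _→-dec_)

indicator : Bool → ℕ
indicator b = if b then 1 else 0

indicator-mono : ∀ {x y} → (x ≡ true → y ≡ true) → indicator x ≤ indicator y
indicator-mono {false} _ = z≤n
indicator-mono {true} x⇒y rewrite x⇒y refl = ℕ.≤-refl

count-suc : ∀ {k} (p : Fin (suc k) → Bool) → count p ≡ indicator (p zero) + count (p ∘ suc)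
count-suc p = cong (indicator (p zero) +_) (cong sum
  (trans (map-tabulate suc (indicator ∘ p)) (sym (map-tabulate id (indicator ∘ p ∘ suc)))))

count-punchIn : ∀ {k} (p : Fin (suc k) → Bool) e → count p ≡ indicator (p e) + count (p ∘ punchIn e)
count-punchIn p zero = count-suc p
count-punchIn {suc k} p (suc e) = begin
  count p
    ≡⟨ count-suc p ⟩
  a + count (p ∘ suc)
    ≡⟨ cong (a +_) (count-punchIn (p ∘ suc) e) ⟩
  a + (b + count (p ∘ suc ∘ punchIn e))
    ≡⟨ x∙yz≈y∙xz a b _ ⟩
  b + (a + count (p ∘ suc ∘ punchIn e))
    ≡⟨ cong (b +_) (count-suc (p ∘ punchIn (suc e))) ⟨
  b + count (p ∘ punchIn (suc e))
    ∎
  where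
  open ≡-Reasoning
  a b : ℕ
  a = indicator (p zero)
  b = indicator (p (suc e))

count-cong : ∀ {k} {p q : Fin k → Bool} → (∀ i → p i ≡ q i) → count p ≡ count q
count-cong {k} p≗q = cong sum (map-cong (cong indicator ∘ p≗q) (allFin k))

count-mono : ∀ {k} {p q : Fin k → Bool} → (∀ i → p i ≡ true → q i ≡ true) →
  count p ≤ count q
count-mono {zero} _ = z≤n
count-mono {suc k} {p} {q} p⇒q = begin
  count p                              ≡⟨ count-suc p ⟩
  indicator (p zero) + count (p ∘ suc) ≤⟨ ℕ.+-mono-≤ (indicator-mono (p⇒q zero))
                                                     (count-mono (p⇒q ∘ suc)) ⟩
  indicator (q zero) + count (q ∘ suc) ≡⟨ count-suc q ⟨
  count q                              ∎
  where open ℕ.≤-Reasoning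

count-pos : ∀ {k} (p : Fin k → Bool) → 0 < count p → ∃[ i ] p i ≡ true
count-pos {zero} p ()
count-pos {suc k} p pos rewrite count-suc p with p zero in p0
... | true = zero , p0
... | false with count-pos (p ∘ suc) pos
...   | i , pi = suc i , pi

==-refl : ∀ {k} (x : Fin k) → (x == x) ≡ true
==-refl x = trans (isYes≗does (x ≟ x)) (dec-true (x ≟ x) refl)

≢⇒==false : ∀ {k} {x y : Fin k} → x ≢ y → (x == y) ≡ false
≢⇒==false {x = x} {y} x≢y = trans (isYes≗does (x ≟ y)) (dec-false (x ≟ y) x≢y)

==true⇒≡ : ∀ {k} {x y : Fin k} → (x == y) ≡ true → x ≡ y
==true⇒≡ {x = x} {y} eq with x ≟ y
... | yes x≡y = x≡y

-- Deleting an edge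

-- Variants of punchIn and insertAt for Fin k instead of Fin (suc k): they make G ∖ e
-- well typed for every graph G, without knowing that m G is a successor.
punchIn′ : ∀ {k} → Fin k → Fin (pred k) → Fin k
punchIn′ {suc k} = punchIn

punchIn′-onto : ∀ {k} {e g : Fin k} → e ≢ g → ∃[ j ] punchIn′ e j ≡ g
punchIn′-onto {suc k} e≢g = punchOut e≢g , punchIn-punchOut e≢g

insertAt′ : ∀ {k} {A : Set} → (Fin (pred k) → A) → Fin k → A → Fin k → A
insertAt′ {suc k} = insertAt

insertAt′-lookup : ∀ {k} {A : Set} (f : Fin (pred k) → A) (e : Fin k) x → insertAt′ f e x e ≡ x
insertAt′-lookup {suc k} f e x = insertAt-lookup f e x

insertAt′-punchIn′ : ∀ {k} {A : Set} (f : Fin (pred k) → A) (e : Fin k) x j →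
  insertAt′ f e x (punchIn′ e j) ≡ f j
insertAt′-punchIn′ {suc k} f e x j = insertAt-punchIn f e x j

count-punchIn′ : ∀ {k} (p : Fin k → Bool) (e : Fin k) →
  count p ≡ indicator (p e) + count (p ∘ punchIn′ e)
count-punchIn′ {suc k} = count-punchIn

_∖_ : (G : Graph) → Fin (m G) → Graph
G ∖ e = record
  { n = n G ; m = pred (m G)
  ; end₁ = end₁ G ∘ punchIn′ e ; end₂ = end₂ G ∘ punchIn′ e
  ; loopless = loopless G ∘ punchIn′ e }

incident : (G : Graph) → Fin (m G) → Vertex G → Bool
incident G e v = if end₁ G e == v then true else end₂ G e == v

tailAlong : (G : Graph) → Fin (m G) → Bool → Vertex G
tailAlong G e β = if β then end₁ G e else end₂ G e

IsEnd : (G : Graph) → Fin (m G) → Vertex G → Set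
IsEnd G e v = v ≡ end₁ G e ⊎ v ≡ end₂ G e

incident-tailAlong : ∀ G e β → incident G e (tailAlong G e β) ≡ true
incident-tailAlong G e true = cong (if_then true else (end₂ G e == end₁ G e)) (==-refl (end₁ G e))
incident-tailAlong G e false with end₁ G e == end₂ G e
... | true = refl
... | false = ==-refl (end₂ G e)

tailOf-incident : ∀ G O e v → (tailOf G O e == v) ≡ true → incident G e v ≡ true
tailOf-incident G O e v tail≡v with O e
... | true rewrite tail≡v = refl
... | false with end₁ G e == v
...   | true = refl
...   | false = tail≡v

deg-∖ : ∀ G e v → deg G v ≡ indicator (incident G e v) + deg (G ∖ e) v
deg-∖ G e v = count-punchIn′ (λ g → incident G g v) e

deg-∖-≤ : ∀ G e v → deg (G ∖ e) v ≤ deg G v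
deg-∖-≤ G e v = subst (deg (G ∖ e) v ≤_) (sym (deg-∖ G e v)) (ℕ.m≤n+m _ _)

deg-∖-incident : ∀ G e v → incident G e v ≡ true → deg G v ≡ suc (deg (G ∖ e) v)
deg-∖-incident G e v e∋v = trans (deg-∖ G e v) (cong (λ b → indicator b + deg (G ∖ e) v) e∋v)

outdeg≤deg : ∀ G O v → outdeg G O v ≤ deg G v
outdeg≤deg G O v = count-mono (λ e → tailOf-incident G O e v)

outdeg-cong : ∀ G {O O′} → (∀ e → O e ≡ O′ e) → ∀ v → outdeg G O v ≡ outdeg G O′ v
outdeg-cong G O≗O′ v = count-cong (λ e → cong (λ β → tailAlong G e β == v) (O≗O′ e))

outdeg-∖ : ∀ G O e v →
  outdeg G O v ≡ indicator (tailOf G O e == v) + outdeg (G ∖ e) (O ∘ punchIn′ e) v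
outdeg-∖ G O e v = count-punchIn′ (λ g → tailOf G O g == v) e

outdeg-∖-tail : ∀ G O e {t} → tailOf G O e ≡ t →
  outdeg G O t ≡ suc (outdeg (G ∖ e) (O ∘ punchIn′ e) t)
outdeg-∖-tail G O e refl = trans (outdeg-∖ G O e _)
  (cong (λ b → indicator b + outdeg (G ∖ e) (O ∘ punchIn′ e) (tailOf G O e)) (==-refl (tailOf G O e)))

outdeg-∖-other : ∀ G O e {t v} → tailOf G O e ≡ t → v ≢ t →
  outdeg G O v ≡ outdeg (G ∖ e) (O ∘ punchIn′ e) v
outdeg-∖-other G O e {v = v} refl v≢t = trans (outdeg-∖ G O e v)
  (cong (λ b → indicator b + outdeg (G ∖ e) (O ∘ punchIn′ e) v) (≢⇒==false (v≢t ∘ sym)))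

tailOf-insertAt′ : ∀ G e O′ β → tailOf G (insertAt′ O′ e β) e ≡ tailAlong G e β
tailOf-insertAt′ G e O′ β = cong (tailAlong G e) (insertAt′-lookup O′ e β)

outdeg-∖-insertAt′ : ∀ G e O′ β v →
  outdeg (G ∖ e) (insertAt′ O′ e β ∘ punchIn′ e) v ≡ outdeg (G ∖ e) O′ v
outdeg-∖-insertAt′ G e O′ β = outdeg-cong (G ∖ e) (insertAt′-punchIn′ O′ e β)

outdeg-insertAt′-tail : ∀ G e O′ β →
  outdeg G (insertAt′ O′ e β) (tailAlong G e β) ≡ suc (outdeg (G ∖ e) O′ (tailAlong G e β))
outdeg-insertAt′-tail G e O′ β =
  trans (outdeg-∖-tail G _ e (tailOf-insertAt′ G e O′ β))
        (cong suc (outdeg-∖-insertAt′ G e O′ β _))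

outdeg-insertAt′-other : ∀ G e O′ β {v} → v ≢ tailAlong G e β →
  outdeg G (insertAt′ O′ e β) v ≡ outdeg (G ∖ e) O′ v
outdeg-insertAt′-other G e O′ β v≢t =
  trans (outdeg-∖-other G _ e (tailOf-insertAt′ G e O′ β) v≢t) (outdeg-∖-insertAt′ G e O′ β _)

record Link (G : Graph) (e : Fin (m G)) (p : Vertex G) : Set where
  constructor link
  field
    out      : Bool
    tail-out : tailAlong G e out ≡ p

  far : Vertex G
  far = tailAlong G e (not out)

open Link

link-incident : ∀ G {e p} → incident G e p ≡ true → Link G e p
link-incident G {e} {p} e∋p with end₁ G e ≟ p
... | yes refl = link true refl
... | no _ = link false (==true⇒≡ e∋p)

far-≢ : ∀ {G e p} (L : Link G e p) → p ≢ far L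
far-≢ {G} {e} (link true refl) = loopless G e
far-≢ {G} {e} (link false refl) = loopless G e ∘ sym

far-incident : ∀ {G e p} (L : Link G e p) → incident G e (far L) ≡ true
far-incident {G} {e} L = incident-tailAlong G e (not (out L))

far-adj : ∀ {G e p} (L : Link G e p) → Adj G (far L) p
far-adj {e = e} (link true refl) = e , inj₂ (refl , refl)
far-adj {e = e} (link false refl) = e , inj₁ (refl , refl)

tailAlong-link : ∀ {G e p} (L : Link G e p) β → tailAlong G e β ≡ p ⊎ tailAlong G e β ≡ far L
tailAlong-link (link true refl) true = inj₁ refl
tailAlong-link (link true refl) false = inj₂ refl
tailAlong-link (link false refl) true = inj₂ refl
tailAlong-link (link false refl) false = inj₁ refl

IsEnd-link : ∀ {G e p y} (L : Link G e p) → IsEnd G e y → y ≡ p ⊎ y ≡ far L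
IsEnd-link L (inj₁ refl) = tailAlong-link L true
IsEnd-link L (inj₂ refl) = tailAlong-link L false

Walk : (G : Graph) → Vertex G → Vertex G → Set
Walk G = WalkAvoiding G (λ _ → ⊤)

walk-head : ∀ {G P x y} → WalkAvoiding G P x y → P x
walk-head (here px) = px
walk-head (step px _ _) = px

walk-snoc : ∀ {G P x y z} → WalkAvoiding G P x y → Adj G y z → P z → WalkAvoiding G P x z
walk-snoc (here px) y~z pz = step px y~z (here pz)
walk-snoc (step px x~y w) y~z pz = step px x~y (walk-snoc w y~z pz)

walk-map : ∀ {G} {P Q : Vertex G → Set} {x y} → (∀ {v} → P v → Q v) →
  WalkAvoiding G P x y → WalkAvoiding G Q x y
walk-map P⇒Q (here px) = here (P⇒Q px)
walk-map P⇒Q (step px x~y w) = step (P⇒Q px) x~y (walk-map P⇒Q w)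

walk-∖ : ∀ {G P x z} (e : Fin (m G)) → WalkAvoiding G P x z →
  WalkAvoiding (G ∖ e) P x z ⊎
  ∃[ y ] (IsEnd G e y × WalkAvoiding (G ∖ e) P x y × P (end₁ G e) × P (end₂ G e))
walk-∖ e (here px) = inj₁ (here px)
walk-∖ {G} {P} {x} e (step px (g , x~y) w) with e ≟ g
... | yes refl = inj₂ (x , first-use x~y (walk-head w))
  where
  first-use : ∀ {y} → (end₁ G e ≡ x × end₂ G e ≡ y) ⊎ (end₁ G e ≡ y × end₂ G e ≡ x) → P y →
    IsEnd G e x × WalkAvoiding (G ∖ e) P x x × P (end₁ G e) × P (end₂ G e)
  first-use (inj₁ (refl , refl)) py = inj₁ refl , here px , px , py
  first-use (inj₂ (refl , refl)) py = inj₂ refl , here px , py , px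
... | no e≢g with punchIn′-onto e≢g | walk-∖ e w
...   | j , refl | inj₁ w′ = inj₁ (step px (j , x~y) w′)
...   | j , refl | inj₂ (y , y∈e , w′ , P-ends) = inj₂ (y , y∈e , step px (j , x~y) w′ , P-ends)

-- Orientations respecting H outside a set of free vertices

DenseAssignment : (G : Graph) → ListAssignment G → Set
DenseAssignment G H = ∀ v i → i < deg G v → ¬ (H v i ≡ true) → H v (suc i) ≡ true

dense-∖ : ∀ G {H} e → DenseAssignment G H → DenseAssignment (G ∖ e) H
dense-∖ G e dense v i i<deg = dense v i (ℕ.≤-trans i<deg (deg-∖-≤ G e v))

RespectsOutside : (G : Graph) → ListAssignment G → (Vertex G → Bool) → Orientation G → Set
RespectsOutside G H F O = ∀ x → F x ≡ false → H x (outdeg G O x) ≡ true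

FreeReachable : (G : Graph) → (Vertex G → Bool) → Set
FreeReachable G F = ∀ z → ¬ ¬ (∃[ f ] (F f ≡ true × Walk G z f))

Touches : (G : Graph) → (Vertex G → Bool) → Fin (m G) → Set
Touches G F g = F (end₁ G g) ≡ true ⊎ F (end₂ G g) ≡ true

free-closed : ∀ {G F z f} → (∀ g → ¬ Touches G F g) → Walk G z f → F f ≡ true → F z ≡ true
free-closed untouched (here _) Ff = Ff
free-closed untouched (step _ (g , inj₁ (refl , refl)) w) Ff =
  ⊥-elim (untouched g (inj₂ (free-closed untouched w Ff)))
free-closed untouched (step _ (g , inj₂ (refl , refl)) w) Ff =
  ⊥-elim (untouched g (inj₁ (free-closed untouched w Ff)))

all-free-respecting : ∀ {G H F} → (∀ g → ¬ Touches G F g) → FreeReachable G F →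
  ∃ (RespectsOutside G H F)
all-free-respecting untouched reach =
  (λ _ → true) ,
  λ x Fx → ⊥-elim (reach x λ (f , Ff , w) → Bool.not-¬ Fx (free-closed untouched w Ff))

-- Making the far end q of an edge e at a free vertex p free as well, an orientation of G ∖ e
-- extends to G: direct e from p to q if H already accepts the out-degree of q, and from q to p
-- otherwise, which density allows.
extend-respecting : ∀ {G H F e p} (L : Link G e p) → F p ≡ true → DenseAssignment G H → ∀ O′ →
  RespectsOutside (G ∖ e) H (λ x → F x ∨ (x == far L)) O′ → ∃ (RespectsOutside G H F)
extend-respecting {G} {H} {F} {e} {p} L Fp dense O′ respects′ = choose _ refl
  where
  q : Vertex G
  q = far L

  unchanged : ∀ β x → F x ≡ false → x ≢ q → H x (outdeg G (insertAt′ O′ e β) x) ≡ true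
  unchanged β x Fx x≢q = trans (cong (H x) (outdeg-insertAt′-other G e O′ β x≢t))
                               (respects′ x (cong₂ _∨_ Fx (≢⇒==false x≢q)))
    where
    x≢t : x ≢ tailAlong G e β
    x≢t x≡t with tailAlong-link L β
    ... | inj₁ t≡p = Bool.not-¬ Fx (trans (cong F (trans x≡t t≡p)) Fp)
    ... | inj₂ t≡q = x≢q (trans x≡t t≡q)

  respecting : ∀ β → H q (outdeg G (insertAt′ O′ e β) q) ≡ true →
    RespectsOutside G H F (insertAt′ O′ e β)
  respecting β Hq x Fx with x ≟ q
  ... | yes refl = Hq
  ... | no x≢q = unchanged β x Fx x≢q

  q≢p : q ≢ tailAlong G e (out L)
  q≢p q≡t = far-≢ L (sym (trans q≡t (tail-out L)))

  outdeg<deg : outdeg (G ∖ e) O′ q < deg G q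
  outdeg<deg = subst (outdeg (G ∖ e) O′ q <_) (sym (deg-∖-incident G e q (far-incident L)))
                     (s≤s (outdeg≤deg (G ∖ e) O′ q))

  choose : ∀ b → H q (outdeg (G ∖ e) O′ q) ≡ b → ∃ (RespectsOutside G H F)
  choose true Hq = _ , respecting (out L)
    (trans (cong (H q) (outdeg-insertAt′-other G e O′ (out L) q≢p)) Hq)
  choose false Hq = _ , respecting (not (out L))
    (trans (cong (H q) (outdeg-insertAt′-tail G e O′ (not (out L))))
           (dense q _ outdeg<deg (Bool.not-¬ Hq)))

respecting-orientation : ∀ k (G : Graph) → m G ≡ k → ∀ {H F} →
  DenseAssignment G H → FreeReachable G F → ∃ (RespectsOutside G H F)
respecting-orientation zero G m≡0 {H} _ reach =
  all-free-respecting {H = H} (λ g _ → ¬Fin0 (subst Fin m≡0 g)) reach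
respecting-orientation (suc k) G m≡k {H} {F} dense reach
  with any? (λ g → (F (end₁ G g) Bool.≟ true) ⊎-dec (F (end₂ G g) Bool.≟ true))
... | no untouched = all-free-respecting {H = H} (λ g touch → untouched (g , touch)) reach
... | yes (e , touch) = go (touching-link touch)
  where
  touching-link : Touches G F e → ∃[ p ] (F p ≡ true × Link G e p)
  touching-link (inj₁ F₁) = _ , F₁ , link true refl
  touching-link (inj₂ F₂) = _ , F₂ , link false refl

  go : ∃[ p ] (F p ≡ true × Link G e p) → ∃ (RespectsOutside G H F)
  go (p , Fp , L) = extend-respecting {H = H} L Fp dense _ (proj₂ respecting′)
    where
    F′ : Vertex G → Bool
    F′ x = F x ∨ (x == far L)

    F′-ends : ∀ {y} → IsEnd G e y → F′ y ≡ true
    F′-ends y∈e with IsEnd-link L y∈e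
    ... | inj₁ refl = cong (_∨ (p == far L)) Fp
    ... | inj₂ refl = trans (cong (F (far L) ∨_) (==-refl (far L))) (Bool.∨-zeroʳ (F (far L)))

    reach′ : FreeReachable (G ∖ e) F′
    reach′ z ¬reach′ = reach z λ (f , Ff , w) → ¬reach′ (shorten f Ff (walk-∖ e w))
      where
      shorten : ∀ f → F f ≡ true → _ → ∃[ y ] (F′ y ≡ true × Walk (G ∖ e) z y)
      shorten f Ff (inj₁ w′) = f , cong (_∨ (f == far L)) Ff , w′
      shorten f Ff (inj₂ (y , y∈e , w′ , _)) = y , F′-ends y∈e , w′

    respecting′ : ∃ (RespectsOutside (G ∖ e) H F′)
    respecting′ = respecting-orientation k (G ∖ e) (cong pred m≡k) (dense-∖ G e dense) reach′

-- The set D⁺ of out-degrees at u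

InDplus-≤ : ∀ G H u {d} → deg G u ≡ d → ∀ {k} → InDplus G H u k → k ≤ d
InDplus-≤ G H u refl (O , refl , _) = outdeg≤deg G O u

∃-Bool-function? : ∀ {k} {P : (Fin k → Bool) → Set} → (∀ {f g} → (∀ i → f i ≡ g i) → P f → P g) →
  (∀ f → Dec (P f)) → Dec (∃ P)
∃-Bool-function? resp P? =
  map′ (λ (s , Ps) → lookup s , Ps) (λ (f , Pf) → tabulate f , resp (sym ∘ lookup∘tabulate f) Pf)
       (anySubset? (P? ∘ lookup))

InDplus? : ∀ G H u k → Dec (InDplus G H u k)
InDplus? G H u k = ∃-Bool-function? respects-cong λ O →
  (outdeg G O u ℕ.≟ k) ×-dec all? (λ x → ¬? (x ≟ u) →-dec (H x (outdeg G O x) Bool.≟ true))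
  where
  respects-cong : ∀ {O O′} → (∀ e → O e ≡ O′ e) →
    outdeg G O u ≡ k × (∀ x → x ≢ u → H x (outdeg G O x) ≡ true) →
    outdeg G O′ u ≡ k × (∀ x → x ≢ u → H x (outdeg G O′ x) ≡ true)
  respects-cong O≗O′ (outdeg≡k , respects) =
    trans (sym (outdeg-cong G O≗O′ u)) outdeg≡k ,
    λ x x≢u → trans (cong (H x) (sym (outdeg-cong G O≗O′ x))) (respects x x≢u)

Uncut : (G : Graph) → Vertex G → Set
Uncut G u = ∀ x y → x ≢ u → y ≢ u → ¬ ¬ WalkAvoiding G (λ z → z ≢ u) x y

record Admissible (G : Graph) (H : ListAssignment G) (u : Vertex G) : Set where
  field
    dense   : DenseAssignment G H
    reaches : ∀ x → ¬ ¬ Walk G x u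
    uncut   : Uncut G u

open Admissible

InDplus-nonempty : ∀ {G H u} → Admissible G H u → ∃ (InDplus G H u)
InDplus-nonempty {G} {H} {u} adm = InDplus-of (respecting-orientation (m G) G refl (dense adm) reach)
  where
  reach : FreeReachable G (_== u)
  reach z ¬reach = reaches adm z λ w → ¬reach (u , ==-refl u , w)

  InDplus-of : ∃ (RespectsOutside G H (_== u)) → ∃ (InDplus G H u)
  InDplus-of (O , respects) = outdeg G O u , O , refl , λ x x≢u → respects x (≢⇒==false x≢u)

shiftAt : ∀ {k} → (Fin k → ℕ → Bool) → Fin k → Fin k → ℕ → Bool
shiftAt H w x i = if x == w then H x (suc i) else H x i

shiftAt-at : ∀ {k} (H : Fin k → ℕ → Bool) w i → shiftAt H w w i ≡ H w (suc i)
shiftAt-at H w i = cong (if_then H w (suc i) else H w i) (==-refl w)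

shiftAt-other : ∀ {k} (H : Fin k → ℕ → Bool) {w x} i → x ≢ w → shiftAt H w x i ≡ H x i
shiftAt-other H {w} {x} i x≢w = cong (if_then H x (suc i) else H x i) (≢⇒==false x≢w)

dense-shiftAt : ∀ G {H} e {w} → DenseAssignment G H → incident G e w ≡ true →
  DenseAssignment (G ∖ e) (shiftAt H w)
dense-shiftAt G {H} e {w} dense e∋w v i i<deg ¬Hvi with v ≟ w
... | yes refl = dense v (suc i) (subst (suc i <_) (sym (deg-∖-incident G e v e∋w)) (s≤s i<deg)) ¬Hvi
... | no v≢w = dense-∖ G e dense v i i<deg ¬Hvi

record _≐_∪suc_ (D D₁ D₂ : ℕ → Set) : Set where
  field
    ⊇₁ : ∀ {k} → D₁ k → D k
    ⊇₂ : ∀ {k} → D₂ k → D (suc k)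
    ⊆  : ∀ {k} → D k → D₁ k ⊎ ∃[ j ] (k ≡ suc j × D₂ j)

open _≐_∪suc_

-- Orienting the edge e = uw towards u shifts the list of w by one; orienting it away from u
-- raises the out-degree of u by one.
InDplus-split : ∀ {G H e u} (L : Link G e u) →
  InDplus G H u ≐ InDplus (G ∖ e) (shiftAt H (far L)) u ∪suc InDplus (G ∖ e) H u
InDplus-split {G} {H} {e} L@(link β refl) =
  record { ⊇₁ = towards-u ; ⊇₂ = away-from-u ; ⊆ = either-way }
  where
  u w : Vertex G
  u = tailAlong G e β
  w = tailAlong G e (not β)

  u≢w : u ≢ w
  u≢w = far-≢ L

  towards-u : ∀ {k} → InDplus (G ∖ e) (shiftAt H w) u k → InDplus G H u k
  towards-u (O′ , refl , respects′) =
    insertAt′ O′ e (not β) , outdeg-insertAt′-other G e O′ (not β) u≢w , respects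
    where
    respects : ∀ x → x ≢ u → H x (outdeg G (insertAt′ O′ e (not β)) x) ≡ true
    respects x x≢u with x ≟ w
    ... | yes refl = trans (cong (H x) (outdeg-insertAt′-tail G e O′ (not β)))
                           (trans (sym (shiftAt-at H x _)) (respects′ x x≢u))
    ... | no x≢w = trans (cong (H x) (outdeg-insertAt′-other G e O′ (not β) x≢w))
                         (trans (sym (shiftAt-other H _ x≢w)) (respects′ x x≢u))

  away-from-u : ∀ {k} → InDplus (G ∖ e) H u k → InDplus G H u (suc k)
  away-from-u (O′ , refl , respects′) = insertAt′ O′ e β , outdeg-insertAt′-tail G e O′ β ,
    λ x x≢u → trans (cong (H x) (outdeg-insertAt′-other G e O′ β x≢u)) (respects′ x x≢u)

  either-way : ∀ {k} → InDplus G H u k →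
    InDplus (G ∖ e) (shiftAt H w) u k ⊎ ∃[ j ] (k ≡ suc j × InDplus (G ∖ e) H u j)
  either-way (O , refl , respects) with tailAlong-link L (O e)
  ... | inj₁ t≡u = inj₂ (_ , outdeg-∖-tail G O e t≡u , O ∘ punchIn′ e , refl ,
    λ x x≢u → trans (cong (H x) (sym (outdeg-∖-other G O e t≡u x≢u))) (respects x x≢u))
  ... | inj₂ t≡w = inj₁ (O ∘ punchIn′ e , sym (outdeg-∖-other G O e t≡w u≢w) , respects′)
    where
    respects′ : ∀ x → x ≢ u → shiftAt H w x (outdeg (G ∖ e) (O ∘ punchIn′ e) x) ≡ true
    respects′ x x≢u with x ≟ w
    ... | yes refl = trans (cong (H x) (sym (outdeg-∖-tail G O e t≡w))) (respects x x≢u)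
    ... | no x≢w = trans (cong (H x) (sym (outdeg-∖-other G O e t≡w x≢w))) (respects x x≢u)

reaches-via-neighbour : ∀ {G u} → Uncut G u → 0 < deg G u → ∀ x → ¬ ¬ Walk G x u
reaches-via-neighbour {G} {u} uncut pos x with count-pos (λ e → incident G e u) pos
... | e , e∋u with link-incident G e∋u | x ≟ u
...   | L | yes refl = λ ¬walk → ¬walk (here tt)
...   | L | no x≢u = λ ¬walk →
  uncut x (far L) x≢u (far-≢ L ∘ sym)
    λ w → ¬walk (walk-snoc (walk-map (λ _ → tt) w) (far-adj L) tt)

uncut-∖ : ∀ {G u} e → incident G e u ≡ true → Uncut G u → Uncut (G ∖ e) u
uncut-∖ {G} {u} e e∋u uncut x y x≢u y≢u ¬walk′ = uncut x y x≢u y≢u λ w → avoids (walk-∖ e w)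
  where
  avoids : WalkAvoiding (G ∖ e) (λ z → z ≢ u) x y ⊎
           ∃[ z ] (IsEnd G e z × WalkAvoiding (G ∖ e) (λ z → z ≢ u) x z ×
                   end₁ G e ≢ u × end₂ G e ≢ u) → ⊥
  avoids (inj₁ w′) = ¬walk′ w′
  avoids (inj₂ (_ , _ , _ , e₁≢u , e₂≢u)) with link-incident G e∋u
  ... | link true t≡u = e₁≢u t≡u
  ... | link false t≡u = e₂≢u t≡u

admissible-∖ : ∀ {G H H′ u} e → incident G e u ≡ true → 0 < deg (G ∖ e) u →
  DenseAssignment (G ∖ e) H′ → Admissible G H u → Admissible (G ∖ e) H′ u
admissible-∖ {G} {u = u} e e∋u pos dense′ adm =
  record { dense = dense′ ; reaches = reaches-via-neighbour uncut′ pos ; uncut = uncut′ }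
  where
  uncut′ : Uncut (G ∖ e) u
  uncut′ = uncut-∖ e e∋u (uncut adm)

-- Shapes of sets of out-degrees

Shape : (ℕ → Set) → ℕ → Set
Shape D d = (∃[ k ] (D k × D (suc k)))
  ⊎ (∀ k → D k ⇔ (Odd k × k ≤ d))
  ⊎ (∀ k → D k ⇔ (Even k × k ≤ d))

even⇔odd-suc : ∀ k → Even k ⇔ Odd (suc k)
even⇔odd-suc zero = mk⇔ (λ _ → refl) (λ _ → refl)
even⇔odd-suc (suc zero) = mk⇔ (λ ()) (λ ())
even⇔odd-suc (suc (suc k)) = even⇔odd-suc k

odd⇔even-suc : ∀ k → Odd k ⇔ Even (suc k)
odd⇔even-suc zero = mk⇔ (λ ()) (λ ())
odd⇔even-suc (suc zero) = mk⇔ (λ _ → refl) (λ _ → refl)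
odd⇔even-suc (suc (suc k)) = odd⇔even-suc k

shape-≤0 : ∀ {D : ℕ → Set} {k₀} → (∀ {k} → D k → k ≤ 0) → D k₀ → Shape D 0
shape-≤0 {D} bounded D0 with bounded D0
... | z≤n = inj₂ (inj₂ λ k → mk⇔ (to k) (from k))
  where
  to : ∀ k → D k → Even k × k ≤ 0
  to k Dk with bounded Dk
  ... | z≤n = refl , z≤n
  from : ∀ k → Even k × k ≤ 0 → D k
  from zero _ = D0

shape-≤1 : ∀ {D : ℕ → Set} {k₀} → (∀ k → Dec (D k)) → (∀ {k} → D k → k ≤ 1) → D k₀ →
  Shape D 1
shape-≤1 {D} D? bounded Dk₀ with D? 0 | D? 1
... | yes D0 | yes D1 = inj₁ (0 , D0 , D1)
... | yes D0 | no ¬D1 = inj₂ (inj₂ λ k → mk⇔ (to k) (from k))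
  where
  to : ∀ k → D k → Even k × k ≤ 1
  to zero _ = refl , z≤n
  to (suc zero) D1 = ⊥-elim (¬D1 D1)
  to (suc (suc k)) Dk with bounded Dk
  ... | s≤s ()
  from : ∀ k → Even k × k ≤ 1 → D k
  from zero _ = D0
  from (suc zero) (() , _)
  from (suc (suc k)) (_ , s≤s ())
... | no ¬D0 | yes D1 = inj₂ (inj₁ λ k → mk⇔ (to k) (from k))
  where
  to : ∀ k → D k → Odd k × k ≤ 1
  to zero D0 = ⊥-elim (¬D0 D0)
  to (suc zero) _ = refl , s≤s z≤n
  to (suc (suc k)) Dk with bounded Dk
  ... | s≤s ()
  from : ∀ k → Odd k × k ≤ 1 → D k
  from zero (() , _)
  from (suc zero) _ = D1
  from (suc (suc k)) (_ , s≤s ())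
... | no ¬D0 | no ¬D1 with bounded Dk₀
...   | z≤n = ⊥-elim (¬D0 Dk₀)
...   | s≤s z≤n = ⊥-elim (¬D1 Dk₀)

alternating : ∀ {D D₁ D₂ P Q : ℕ → Set} d → D ≐ D₁ ∪suc D₂ → (∀ j → Q j ⇔ P (suc j)) →
  (∀ k → D₁ k ⇔ (P k × k ≤ suc d)) → (∀ k → D₂ k ⇔ (Q k × k ≤ suc d)) →
  ∀ k → D k ⇔ (P k × k ≤ suc (suc d))
alternating {D} {D₁} {D₂} {P} {Q} d split Q⇔P D₁≡ D₂≡ k = mk⇔ to from
  where
  to : D k → P k × k ≤ suc (suc d)
  to Dk with ⊆ split Dk
  ... | inj₁ D₁k = map₂ ℕ.m≤n⇒m≤1+n (Equivalence.to (D₁≡ k) D₁k)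
  ... | inj₂ (j , refl , D₂j) with Equivalence.to (D₂≡ j) D₂j
  ...   | Qj , j≤ = Equivalence.to (Q⇔P j) Qj , s≤s j≤

  from : P k × k ≤ suc (suc d) → D k
  from (Pk , k≤) with ℕ.m≤n⇒m<n∨m≡n k≤
  ... | inj₁ (s≤s k≤′) = ⊇₁ split (Equivalence.from (D₁≡ k) (Pk , k≤′))
  ... | inj₂ refl =
    ⊇₂ split (Equivalence.from (D₂≡ (suc d)) (Equivalence.from (Q⇔P (suc d)) Pk , ℕ.≤-refl))

shape-∪suc : ∀ {D D₁ D₂} d → D ≐ D₁ ∪suc D₂ → Shape D₁ (suc d) → Shape D₂ (suc d) →
  Shape D (suc (suc d))
shape-∪suc d split (inj₁ (k , D₁k , D₁k+1)) _ = inj₁ (k , ⊇₁ split D₁k , ⊇₁ split D₁k+1)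
shape-∪suc d split _ (inj₁ (k , D₂k , D₂k+1)) =
  inj₁ (suc k , ⊇₂ split D₂k , ⊇₂ split D₂k+1)
shape-∪suc d split (inj₂ (inj₁ odd₁)) (inj₂ (inj₁ odd₂)) =
  inj₁ (1 , ⊇₁ split (Equivalence.from (odd₁ 1) (refl , s≤s z≤n))
          , ⊇₂ split (Equivalence.from (odd₂ 1) (refl , s≤s z≤n)))
shape-∪suc d split (inj₂ (inj₂ even₁)) (inj₂ (inj₂ even₂)) =
  inj₁ (0 , ⊇₁ split (Equivalence.from (even₁ 0) (refl , z≤n))
          , ⊇₂ split (Equivalence.from (even₂ 0) (refl , z≤n)))
shape-∪suc d split (inj₂ (inj₁ odd₁)) (inj₂ (inj₂ even₂)) =
  inj₂ (inj₁ (alternating d split even⇔odd-suc odd₁ even₂))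
shape-∪suc d split (inj₂ (inj₂ even₁)) (inj₂ (inj₁ odd₂)) =
  inj₂ (inj₂ (alternating d split odd⇔even-suc even₁ odd₂))

shape-InDplus-step : ∀ d {G H u} → deg G u ≡ suc (suc d) → Admissible G H u →
  (∀ e {H′} → deg (G ∖ e) u ≡ suc d → Admissible (G ∖ e) H′ u →
     Shape (InDplus (G ∖ e) H′ u) (suc d)) →
  Shape (InDplus G H u) (suc (suc d))
shape-InDplus-step d {G} {H} {u} deg≡ adm shape′
  with count-pos (λ e → incident G e u) (subst (0 <_) (sym deg≡) (s≤s z≤n))
... | e , e∋u = shape-∪suc d (InDplus-split {H = H} L)
  (shape′ e deg′ (admissible-∖ e e∋u pos (dense-shiftAt G e (dense adm) (far-incident L)) adm))
  (shape′ e deg′ (admissible-∖ e e∋u pos (dense-∖ G e (dense adm)) adm))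
  where
  L : Link G e u
  L = link-incident G e∋u
  deg′ : deg (G ∖ e) u ≡ suc d
  deg′ = ℕ.suc-injective (trans (sym (deg-∖-incident G e u e∋u)) deg≡)
  pos : 0 < deg (G ∖ e) u
  pos = subst (0 <_) (sym deg′) (s≤s z≤n)

shape-InDplus : ∀ d {G H u} → deg G u ≡ d → Admissible G H u → Shape (InDplus G H u) d
shape-InDplus zero {G} {H} {u} deg≡ adm =
  shape-≤0 (InDplus-≤ G H u deg≡) (proj₂ (InDplus-nonempty adm))
shape-InDplus (suc zero) {G} {H} {u} deg≡ adm =
  shape-≤1 (InDplus? G H u) (InDplus-≤ G H u deg≡) (proj₂ (InDplus-nonempty adm))
shape-InDplus (suc (suc d)) deg≡ adm = shape-InDplus-step d deg≡ adm (λ _ → shape-InDplus (suc d))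

lemma2p3 : (G : Graph) (H : ListAssignment G) → Dense G H →
    (u : Vertex G) → ¬ IsCutVertex G u →
    (∃[ k ] (InDplus G H u k × InDplus G H u (suc k)))
    ⊎ (∀ k → InDplus G H u k ⇔ (Odd k × k ≤ deg G u))
    ⊎ (∀ k → InDplus G H u k ⇔ (Even k × k ≤ deg G u))
lemma2p3 G H (connected , dense) u ¬cut = shape-InDplus (deg G u) refl record
  { dense   = dense
  ; reaches = λ x ¬walk → ¬walk (connected x u)
  ; uncut   = λ x y x≢u y≢u ¬walk → ¬cut (x , y , x≢u , y≢u , connected x y , ¬walk)
  }
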